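{- Assume the ABC conjecture. Then there is an absolute constant $C$ such that $Q_k(N)\le CN^{61/k}$ for all $k\ge2$ and $N\ge1$.
   Context: For $k\ge2$, $N,q\ge1$, $a\in\mathbb{Z}$, $Q_k(N;q,a)$ is the number of $k$-th powers among $a+q,a+2q,\dots,a+Nq$, and $Q_k(N)=\max_{q\ge1,\,a\ge0}Q_k(N;q,a)$. The ABC conjecture: for each $\varepsilon>0$ there is $K_\varepsilon$ such that whenever $a,b,c$ are nonzero integers with $\gcd(a,b,c)=1$ and $a+b=c$, $\max\{|a|,|b|,|c|\}\le K_\varepsilon\operatorname{rad}(abc)^{1+\varepsilon}$, where $\operatorname{rad}(n)=\prod_{p\mid n}p$. -}

module Defs where

open import Data.Nat using (ℕ; zero; suc; _+_; _*_; _^_; _≤_; _≤?_)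
open import Data.Nat.Properties using (_≟_)
open import Data.Nat.Divisibility using (_∣_; _∣?_)
open import Data.Nat.Primality using (Prime; prime?)
open import Data.Nat.GCD using (gcd)
open import Data.Integer as ℤ using (ℤ)
open import Data.List using (List; upTo; filter; length; map)
open import Data.Nat.ListAction using (product)
open import Data.List.Relation.Unary.Any using (any?)
open import Data.Product using (∃; _×_; _,_)
open import Relation.Nullary using (Dec; yes; no; ¬_)
open import Relation.Nullary.Decidable using (_×-dec_)
open import Relation.Binary.PropositionalEquality using (_≡_)

IsKthPower : ℕ → ℕ → Set
IsKthPower k n = ∃ λ m → m ^ k ≡ n

-- decision procedure: any such m satisfies m ≤ n when k ≥ 1 (and for k = 0 it
-- searches m ∈ {0..n}); used only for counting, with k ≥ 2 in the theorem
isKthPower? : ℕ → ℕ → Set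
isKthPower? k n = Data.List.Relation.Unary.Any.Any (λ m → m ^ k ≡ n) (upTo (suc n))

isKthPowerDec : (k n : ℕ) → Dec (isKthPower? k n)
isKthPowerDec k n = any? (λ m → (m ^ k) ≟ n) (upTo (suc n))

Q : (k N q a : ℕ) → ℕ
Q k N q a = length (filter (λ i → isKthPowerDec k (a + i * q)) (map suc (upTo N)))

rad : ℕ → ℕ
rad n = product (filter (λ p → prime? p ×-dec (p ∣? n)) (upTo (suc n)))

abs : ℤ → ℕ
abs = ℤ.∣_∣

max3 : ℕ → ℕ → ℕ → ℕ
max3 x y z = Data.Nat._⊔_ x (Data.Nat._⊔_ y z)

-- ABC conjecture, with ε = e / d (e, d ≥ 1) ranging over positive rationals
-- and K_ε a natural number; max^d ≤ K^d · rad^(d+e) is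
-- max ≤ K · rad^(1+ε) raised to the d-th power.
ABC : Set
ABC = (e d : ℕ) → 1 ≤ e → 1 ≤ d →
      ∃ λ (K : ℕ) → (a b c : ℤ) →
        ¬ a ≡ ℤ.0ℤ → ¬ b ≡ ℤ.0ℤ → ¬ c ≡ ℤ.0ℤ →
        gcd (gcd (abs a) (abs b)) (abs c) ≡ 1 →
        a ℤ.+ b ≡ c →
        max3 (abs a) (abs b) (abs c) ^ d ≤ K ^ d * rad (abs (a ℤ.* b ℤ.* c)) ^ (d + e)

{-# OPTIONS --safe #-}

-- Three k-th powers (xt)ᵏ, (yt)ᵏ, (zt)ᵏ at positions i < j < l ≤ N of a progression a + nq satisfy
-- (l − j)·xᵏ + (j − i)·zᵏ = (l − i)·yᵏ. If gcd(x, y, z) = 1, the gcd of the three summands divides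
-- (l − j)(j − i)(l − i) ≤ N³ and, as x, y ≤ z, the radical of their product is at most (Nz)³; so
-- ABC with ε = 1 for the reduced triple gives zᵏ ≤ K·N⁹·z⁶, i.e. z^(k−6) ≤ K·N⁹.
-- Fix the first two k-th powers x₁ᵏ, x₂ᵏ among a + q, …, a + Nq. Reducing x₁, x₂ and a later
-- root x_r by their gcd writes x_r / x₁ = u / v with 1 ≤ v ≤ u ≤ D, where D^(k−6) ≤ K·N⁹; so
-- there are at most (D + 1)² later powers, Q ≤ 6D², and for k ≥ 62
-- Qᵏ ≤ 6ᵏ·D^(2k) ≤ 6ᵏ·(K·N⁹)³ ≤ (6(K + 1))ᵏ·N⁶¹. For k ≤ 61 the trivial bound Q ≤ N suffices.

module Submission where

open import Defs
open import Algebra.Properties.CommutativeSemigroup using (interchange)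
open import Data.Nat
open import Data.Nat.Properties
open import Data.Nat.Divisibility
open import Data.Nat.DivMod using (_%_; [m+kn]%n≡m%n; m<n⇒m%n≡m)
open import Data.Nat.GCD
open import Data.Nat.Primality
open import Data.Nat.Primality.Factorisation
open import Data.Nat.ListAction using (product)
open import Data.Nat.Solver using (module +-*-Solver)
open import Data.Nat.Tactic.RingSolver using (solve-∀)
open import Data.Integer as ℤ using (+_)
open import Data.Integer.Properties using (abs-*)
open import Data.List using (List; []; _∷_; upTo; filter; length; map)
open import Data.List.Properties
  using (length-map; length-upTo; length-filter; filter-all; filter-accept; filter-reject)
open import Data.List.Extrema.Nat using (argmax; argmax-all; f[⊥]≤f[argmax]; f[xs]≤f[argmax])
open import Data.List.Relation.Unary.All as All using (All; []; _∷_)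
import Data.List.Relation.Unary.All.Properties as All
open import Data.List.Relation.Unary.AllPairs as AllPairs using (AllPairs; []; _∷_)
import Data.List.Relation.Unary.AllPairs.Properties as AllPairs
import Data.List.Relation.Unary.Any as Any
open import Data.List.Relation.Unary.Unique.Propositional using (Unique)
import Data.List.Relation.Unary.Unique.Propositional.Properties as Unique
open import Data.Product using (∃; _×_; _,_; proj₁; proj₂)
open import Data.Sum using (_⊎_; inj₁; inj₂)
open import Function using (id; _∘_)
open import Relation.Nullary using (Dec; yes; no; contradiction)
open import Relation.Nullary.Decidable using (_×-dec_)
open import Relation.Binary.PropositionalEquality

private
  variable
    a b c d m n : ℕ

nonZero-≤ : m ≤ n → .{{_ : NonZero m}} → NonZero n
nonZero-≤ {m} m≤n = >-nonZero (<-≤-trans (>-nonZero⁻¹ m) m≤n)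

m^n≢0⇒m≢0 : ∀ m n .{{_ : NonZero n}} .{{_ : NonZero (m ^ n)}} → NonZero m
m^n≢0⇒m≢0 m (suc n) = m*n≢0⇒m≢0 m

^-cancelˡ-≤ : ∀ k .{{_ : NonZero k}} → m ^ k ≤ n ^ k → m ≤ n
^-cancelˡ-≤ k m^k≤n^k = ≮⇒≥ (λ n<m → <⇒≱ (^-monoˡ-< k n<m) m^k≤n^k)

nonZero-factorˡ : n ≡ m * d → .{{_ : NonZero n}} → NonZero m
nonZero-factorˡ {m = m} refl = m*n≢0⇒m≢0 m

nonZero-factorʳ : n ≡ m * d → .{{_ : NonZero n}} → NonZero d
nonZero-factorʳ {m = m} refl = m*n≢0⇒n≢0 m

^-distribʳ-* : ∀ m n k → (m * n) ^ k ≡ m ^ k * n ^ k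
^-distribʳ-* m n zero    = refl
^-distribʳ-* m n (suc k) = begin
  m * n * (m * n) ^ k      ≡⟨ cong (m * n *_) (^-distribʳ-* m n k) ⟩
  m * n * (m ^ k * n ^ k)  ≡⟨ interchange *-commutativeSemigroup m n (m ^ k) (n ^ k) ⟩
  m * m ^ k * (n * n ^ k)  ∎
  where open ≡-Reasoning

-- Opaque, so that unification never unfolds the well-founded recursion of gcd.
opaque
  gcd₃ : ℕ → ℕ → ℕ → ℕ
  gcd₃ a b c = gcd (gcd a b) c

  gcd₃∣₁ : ∀ a b c → gcd₃ a b c ∣ a
  gcd₃∣₁ a b c = ∣-trans (gcd[m,n]∣m (gcd a b) c) (gcd[m,n]∣m a b)

  gcd₃∣₂ : ∀ a b c → gcd₃ a b c ∣ b
  gcd₃∣₂ a b c = ∣-trans (gcd[m,n]∣m (gcd a b) c) (gcd[m,n]∣n a b)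

  gcd₃∣₃ : ∀ a b c → gcd₃ a b c ∣ c
  gcd₃∣₃ a b c = gcd[m,n]∣n (gcd a b) c

  gcd₃-greatest : d ∣ a → d ∣ b → d ∣ c → d ∣ gcd₃ a b c
  gcd₃-greatest d∣a d∣b d∣c = gcd-greatest (gcd-greatest d∣a d∣b) d∣c

  gcd₃-nonZero : ∀ a b c .{{_ : NonZero a}} → NonZero (gcd₃ a b c)
  gcd₃-nonZero a b c = ≢-nonZero (gcd[m,n]≢0 (gcd a b) c (inj₁ (gcd[m,n]≢0 a b (inj₁ (≢-nonZero⁻¹ a)))))

  c*gcd₃≡gcd₃[c*] : ∀ c a b d → c * gcd₃ a b d ≡ gcd₃ (c * a) (c * b) (c * d)
  c*gcd₃≡gcd₃[c*] c a b d = begin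
    c * gcd (gcd a b) d           ≡⟨ c*gcd[m,n]≡gcd[cm,cn] c (gcd a b) d ⟩
    gcd (c * gcd a b) (c * d)     ≡⟨ cong (λ e → gcd e (c * d)) (c*gcd[m,n]≡gcd[cm,cn] c a b) ⟩
    gcd₃ (c * a) (c * b) (c * d)  ∎
    where open ≡-Reasoning

  gcd₃-definition : ∀ a b c → gcd₃ a b c ≡ gcd (gcd a b) c
  gcd₃-definition a b c = refl

record ScaledPrimitive (a b c : ℕ) : Set where
  field
    scale a′ b′ c′ : ℕ
    a≡a′*scale : a ≡ a′ * scale
    b≡b′*scale : b ≡ b′ * scale
    c≡c′*scale : c ≡ c′ * scale
    coprime : gcd₃ a′ b′ c′ ≡ 1

  scale∣gcd₃ : scale ∣ gcd₃ a b c
  scale∣gcd₃ = gcd₃-greatest (divides a′ a≡a′*scale) (divides b′ b≡b′*scale) (divides c′ c≡c′*scale)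

scaledPrimitive : ∀ a b c .{{_ : NonZero a}} → ScaledPrimitive a b c
scaledPrimitive a b c = record
  { scale = g
  ; a′ = a′
  ; b′ = b′
  ; c′ = c′
  ; a≡a′*scale = m∣n⇒n≡quotient*m g∣a
  ; b≡b′*scale = m∣n⇒n≡quotient*m g∣b
  ; c≡c′*scale = m∣n⇒n≡quotient*m g∣c
  ; coprime = *-cancelˡ-≡ (gcd₃ a′ b′ c′) 1 g (begin
      g * gcd₃ a′ b′ c′                ≡⟨ c*gcd₃≡gcd₃[c*] g a′ b′ c′ ⟩
      gcd₃ (g * a′) (g * b′) (g * c′)  ≡⟨ cong₂ (λ u v → gcd₃ u v (g * c′)) (m∣n⇒n≡m*quotient g∣a)
                                                                            (m∣n⇒n≡m*quotient g∣b) ⟨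
      gcd₃ a b (g * c′)                ≡⟨ cong (gcd₃ a b) (m∣n⇒n≡m*quotient g∣c) ⟨
      g                                ≡⟨ *-identityʳ g ⟨
      g * 1                            ∎)
  }
  where
  open ≡-Reasoning
  g : ℕ
  g = gcd₃ a b c
  instance
    g-nonZero : NonZero g
    g-nonZero = gcd₃-nonZero a b c
  g∣a : g ∣ a
  g∣a = gcd₃∣₁ a b c
  g∣b : g ∣ b
  g∣b = gcd₃∣₂ a b c
  g∣c : g ∣ c
  g∣c = gcd₃∣₃ a b c
  a′ b′ c′ : ℕ
  a′ = quotient g∣a
  b′ = quotient g∣b
  c′ = quotient g∣c

infix 4 _PrimeDivisorsDivide_

_PrimeDivisorsDivide_ : ℕ → ℕ → Set
m PrimeDivisorsDivide n = ∀ {p} → Prime p → p ∣ m → p ∣ n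

*-primeDivisorsDivide : ∀ {m m′ n n′} → m PrimeDivisorsDivide m′ → n PrimeDivisorsDivide n′ →
                        m * n PrimeDivisorsDivide m′ * n′
*-primeDivisorsDivide {m} {m′} {n} {n′} m≼m′ n≼n′ p-prime p∣m*n with euclidsLemma m n p-prime p∣m*n
... | inj₁ p∣m = ∣-trans (m≼m′ p-prime p∣m) (m∣m*n n′)
... | inj₂ p∣n = ∣n⇒∣m*n m′ (n≼n′ p-prime p∣n)

^-primeDivisorsDivide : ∀ n k → n ^ k PrimeDivisorsDivide n
^-primeDivisorsDivide n zero    p-prime p∣1 = contradiction (subst Prime (∣1⇒≡1 p∣1) p-prime) ¬prime[1]
^-primeDivisorsDivide n (suc k) p-prime p∣n^[1+k] with euclidsLemma n (n ^ k) p-prime p∣n^[1+k]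
... | inj₁ p∣n   = p∣n
... | inj₂ p∣n^k = ^-primeDivisorsDivide n k p-prime p∣n^k

*^-primeDivisorsDivide : ∀ m n k → m * n ^ k PrimeDivisorsDivide m * n
*^-primeDivisorsDivide m n k = *-primeDivisorsDivide {m} (λ _ → id) (^-primeDivisorsDivide n k)

primeDivisorsDivide-1 : ∀ n .{{_ : NonZero n}} → n PrimeDivisorsDivide 1 → n ≡ 1
primeDivisorsDivide-1 n n≼1 with factorise n
... | record { factors = [] ; isFactorisation = n≡1 } = n≡1
... | record { factors = p ∷ ps ; isFactorisation = n≡p*∏ps ; factorsPrime = p-prime ∷ _ } =
  contradiction (subst Prime (∣1⇒≡1 (n≼1 p-prime p∣n)) p-prime) ¬prime[1]
  where
  p∣n : p ∣ n
  p∣n = subst (p ∣_) (sym n≡p*∏ps) (m∣m*n (product ps))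

product-∣ : ∀ {ps} → Unique ps → All Prime ps → All (_∣ n) ps → product ps ∣ n
product-∣ [] [] [] = 1∣ _
product-∣ {n} {p ∷ ps} distinct@(_ ∷ ps-distinct) (p-prime ∷ ps-prime) (p∣n ∷ ps∣n)
  with divides o n≡o*∏ps ← product-∣ ps-distinct ps-prime ps∣n
  with euclidsLemma o (product ps) p-prime (subst (p ∣_) n≡o*∏ps p∣n)
... | inj₁ (divides o′ o≡o′*p) = divides o′ (begin
  n                    ≡⟨ n≡o*∏ps ⟩
  o * product ps       ≡⟨ cong (_* product ps) o≡o′*p ⟩
  o′ * p * product ps  ≡⟨ *-assoc o′ p (product ps) ⟩
  o′ * (p * product ps) ∎)
  where open ≡-Reasoning
... | inj₂ p∣∏ps = contradiction (factorisationHasAllPrimeFactors p-prime p∣∏ps ps-prime)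
                                (Unique.Unique[x∷xs]⇒x∉xs distinct)

rad-∣ : m PrimeDivisorsDivide n → rad m ∣ n
rad-∣ {m} m≼n = product-∣ (Unique.filter⁺ P? (Unique.upTo⁺ (suc m)))
  (All.map proj₁ prime∧∣m) (All.map (λ (p-prime , p∣m) → m≼n p-prime p∣m) prime∧∣m)
  where
  P? : ∀ p → Dec (Prime p × p ∣ m)
  P? p = prime? p ×-dec (p ∣? m)
  prime∧∣m : All (λ p → Prime p × p ∣ m) (filter P? (upTo (suc m)))
  prime∧∣m = All.all-filter P? (upTo (suc m))

ABC[ε=1] : ℕ → Set
ABC[ε=1] K = ∀ {a b c} .{{_ : NonZero a}} .{{_ : NonZero b}} →
             gcd₃ a b c ≡ 1 → a + b ≡ c → c ≤ K * rad (a * b * c) ^ 2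

ABC⇒ABC[ε=1] : ABC → ∃ ABC[ε=1]
ABC⇒ABC[ε=1] abc with K , abc-ε=1 ← abc 1 1 (s≤s z≤n) (s≤s z≤n) = K , abc-ℕ
  where
  +≢0 : ∀ {n} → n ≢ 0 → + n ≢ ℤ.0ℤ
  +≢0 n≢0 = n≢0 ∘ cong ℤ.∣_∣

  abc-ℕ : ABC[ε=1] K
  abc-ℕ {a} {b} {c} coprime a+b≡c = begin
    c                        ≤⟨ m≤n⊔m b c ⟩
    b ⊔ c                    ≤⟨ m≤n⊔m a (b ⊔ c) ⟩
    max3 a b c               ≡⟨ ^-identityʳ (max3 a b c) ⟨
    max3 a b c ^ 1           ≤⟨ abc-ε=1 (+ a) (+ b) (+ c) (+≢0 (≢-nonZero⁻¹ a)) (+≢0 (≢-nonZero⁻¹ b)) (+≢0 c≢0)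
                                         (trans (sym (gcd₃-definition a b c)) coprime) (cong +_ a+b≡c) ⟩
    K ^ 1 * rad (abs (+ a ℤ.* + b ℤ.* + c)) ^ 2
      ≡⟨ cong₂ (λ K′ n → K′ * rad n ^ 2) (^-identityʳ K)
               (trans (abs-* (+ a ℤ.* + b) (+ c)) (cong (_* c) (abs-* (+ a) (+ b)))) ⟩
    K * rad (a * b * c) ^ 2  ∎
    where
    open ≤-Reasoning
    c≢0 : c ≢ 0
    c≢0 c≡0 = ≢-nonZero⁻¹ a (m+n≡0⇒m≡0 a (trans a+b≡c c≡0))

abc-up-to-gcd₃ : ∀ {K M a b c} → ABC[ε=1] K → .{{_ : NonZero a}} .{{_ : NonZero b}} .{{_ : NonZero M}} →
                 a + b ≡ c → a * b * c PrimeDivisorsDivide M → c ≤ K * M ^ 2 * gcd₃ a b c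
abc-up-to-gcd₃ {K} {M} {a} {b} {c} abc a+b≡c abc≼M = begin
  c                                        ≡⟨ c≡c′*scale ⟩
  c′ * scale                               ≤⟨ *-mono-≤ (abc {a′} {b′} {c′} coprime a′+b′≡c′) (∣⇒≤ scale∣gcd₃) ⟩
  K * rad (a′ * b′ * c′) ^ 2 * gcd₃ a b c  ≤⟨ *-monoˡ-≤ (gcd₃ a b c) (*-monoʳ-≤ K (^-monoˡ-≤ 2 rad≤M)) ⟩
  K * M ^ 2 * gcd₃ a b c                   ∎
  where
  open ≤-Reasoning
  open ScaledPrimitive (scaledPrimitive a b c)
  instance
    gcd-nonZero : NonZero (gcd₃ a b c)
    gcd-nonZero = gcd₃-nonZero a b c
    a′-nonZero : NonZero a′
    a′-nonZero = nonZero-factorˡ {d = scale} a≡a′*scale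
    b′-nonZero : NonZero b′
    b′-nonZero = nonZero-factorˡ {d = scale} b≡b′*scale
    scale-nonZero : NonZero scale
    scale-nonZero = nonZero-factorʳ {m = a′} a≡a′*scale

  a′+b′≡c′ : a′ + b′ ≡ c′
  a′+b′≡c′ = *-cancelʳ-≡ (a′ + b′) c′ scale (begin-equality
    (a′ + b′) * scale         ≡⟨ *-distribʳ-+ scale a′ b′ ⟩
    a′ * scale + b′ * scale   ≡⟨ cong₂ _+_ a≡a′*scale b≡b′*scale ⟨
    a + b                     ≡⟨ a+b≡c ⟩
    c                         ≡⟨ c≡c′*scale ⟩
    c′ * scale                ∎)

  a′b′c′∣abc : a′ * b′ * c′ ∣ a * b * c
  a′b′c′∣abc = *-pres-∣ (*-pres-∣ (quotient∣ a′ a≡a′*scale) (quotient∣ b′ b≡b′*scale)) (quotient∣ c′ c≡c′*scale)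
    where
    quotient∣ : ∀ {n} q → n ≡ q * scale → q ∣ n
    quotient∣ q n≡q*scale = divides scale (trans n≡q*scale (*-comm q scale))

  rad≤M : rad (a′ * b′ * c′) ≤ M
  rad≤M = ∣⇒≤ (rad-∣ (λ p-prime p∣a′b′c′ → abc≼M p-prime (∣-trans p∣a′b′c′ a′b′c′∣abc)))

gcd₃-^ : ∀ {x y z} k .{{_ : NonZero x}} → gcd₃ x y z ≡ 1 → gcd₃ (x ^ k) (y ^ k) (z ^ k) ≡ 1
gcd₃-^ {x} {y} {z} k coprime =
  primeDivisorsDivide-1 (gcd₃ (x ^ k) (y ^ k) (z ^ k)) {{gcd₃-nonZero (x ^ k) (y ^ k) (z ^ k) {{m^n≢0 x k}}}}
    λ p-prime p∣gcd → subst (_ ∣_) coprime (gcd₃-greatest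
      (^-primeDivisorsDivide x k p-prime (∣-trans p∣gcd (gcd₃∣₁ _ _ _)))
      (^-primeDivisorsDivide y k p-prime (∣-trans p∣gcd (gcd₃∣₂ _ _ _)))
      (^-primeDivisorsDivide z k p-prime (∣-trans p∣gcd (gcd₃∣₃ _ _ _))))

gcd₃[ux,vy,wz]∣uvw : ∀ u v w {x y z} → gcd₃ x y z ≡ 1 → gcd₃ (u * x) (v * y) (w * z) ∣ u * v * w
gcd₃[ux,vy,wz]∣uvw u v w {x} {y} {z} coprime = begin
  gcd₃ (u * x) (v * y) (w * z)       ∣⟨ gcd₃-greatest
                                          (∣-trans (gcd₃∣₁ _ _ _) (*-monoˡ-∣ x (∣-trans (m∣m*n {u} v) (m∣m*n w))))
                                          (∣-trans (gcd₃∣₂ _ _ _) (*-monoˡ-∣ y (n∣m*n*o u w)))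
                                          (∣-trans (gcd₃∣₃ _ _ _) (*-monoˡ-∣ z (n∣m*n (u * v)))) ⟩
  gcd₃ (uvw * x) (uvw * y) (uvw * z)  ≡⟨ c*gcd₃≡gcd₃[c*] uvw x y z ⟨
  uvw * gcd₃ x y z                    ≡⟨ cong (uvw *_) coprime ⟩
  uvw * 1                             ≡⟨ *-identityʳ uvw ⟩
  uvw                                 ∎
  where
  open ∣-Reasoning
  uvw : ℕ
  uvw = u * v * w

three-term-AP : ∀ a q i d₁ d₂ →
  d₂ * (a + i * q) + d₁ * (a + (i + d₁ + d₂) * q) ≡ (d₁ + d₂) * (a + (i + d₁) * q)
three-term-AP = solve-∀

powers-in-AP : ∀ {a q i d₁ d₂ k t x y z} .{{_ : NonZero t}} →
  (x * t) ^ k ≡ a + i * q → (y * t) ^ k ≡ a + (i + d₁) * q → (z * t) ^ k ≡ a + (i + d₁ + d₂) * q →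
  d₂ * x ^ k + d₁ * z ^ k ≡ (d₁ + d₂) * y ^ k
powers-in-AP {a} {q} {i} {d₁} {d₂} {k} {t} {x} {y} {z} xₜ yₜ zₜ =
  *-cancelʳ-≡ _ _ (t ^ k) {{m^n≢0 t k}} (begin
    (d₂ * x ^ k + d₁ * z ^ k) * t ^ k                ≡⟨ *-distribʳ-+ (t ^ k) (d₂ * x ^ k) (d₁ * z ^ k) ⟩
    d₂ * x ^ k * t ^ k + d₁ * z ^ k * t ^ k          ≡⟨ cong₂ _+_ (scaled d₂ x) (scaled d₁ z) ⟩
    d₂ * (x * t) ^ k + d₁ * (z * t) ^ k              ≡⟨ cong₂ (λ u v → d₂ * u + d₁ * v) xₜ zₜ ⟩
    d₂ * (a + i * q) + d₁ * (a + (i + d₁ + d₂) * q)  ≡⟨ three-term-AP a q i d₁ d₂ ⟩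
    (d₁ + d₂) * (a + (i + d₁) * q)                   ≡⟨ cong ((d₁ + d₂) *_) yₜ ⟨
    (d₁ + d₂) * (y * t) ^ k                          ≡⟨ scaled (d₁ + d₂) y ⟨
    (d₁ + d₂) * y ^ k * t ^ k                        ∎)
  where
  open ≡-Reasoning
  scaled : ∀ d u → d * u ^ k * t ^ k ≡ d * (u * t) ^ k
  scaled d u = trans (*-assoc d (u ^ k) (t ^ k)) (cong (d *_) (sym (^-distribʳ-* u t k)))

AP-powers-mono : ∀ {a q i j} k {m n} .{{_ : NonZero k}} →
  m ^ k ≡ a + i * q → n ^ k ≡ a + j * q → i ≤ j → m ≤ n
AP-powers-mono {a} {q} k mᵏ nᵏ i≤j =
  ^-cancelˡ-≤ k (subst₂ _≤_ (sym mᵏ) (sym nᵏ) (+-monoʳ-≤ a (*-monoˡ-≤ q i≤j)))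

abc-three-powers : ∀ {K k d₁ d₂ x y z} → ABC[ε=1] K →
  .{{_ : NonZero d₁}} .{{_ : NonZero d₂}} .{{_ : NonZero x}} .{{_ : NonZero y}} .{{_ : NonZero z}} →
  gcd₃ x z y ≡ 1 → d₂ * x ^ k + d₁ * z ^ k ≡ (d₁ + d₂) * y ^ k →
  (d₁ + d₂) * y ^ k ≤ K * (d₂ * x * (d₁ * z) * ((d₁ + d₂) * y)) ^ 2 * (d₂ * d₁ * (d₁ + d₂))
abc-three-powers {K} {k} {d₁} {d₂} {x} {y} {z} abc coprime identity = begin
  C                       ≤⟨ abc-up-to-gcd₃ {K} {M} {A} {B} {C} abc identity ABC≼M ⟩
  K * M ^ 2 * gcd₃ A B C  ≤⟨ *-monoʳ-≤ (K * M ^ 2) (∣⇒≤ gcd₃∣P) ⟩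
  K * M ^ 2 * P           ∎
  where
  open ≤-Reasoning
  A B C M P : ℕ
  A = d₂ * x ^ k
  B = d₁ * z ^ k
  C = (d₁ + d₂) * y ^ k
  M = d₂ * x * (d₁ * z) * ((d₁ + d₂) * y)
  P = d₂ * d₁ * (d₁ + d₂)
  instance
    d₁+d₂-nonZero : NonZero (d₁ + d₂)
    d₁+d₂-nonZero = nonZero-≤ (m≤m+n d₁ d₂)
    xᵏ-nonZero : NonZero (x ^ k)
    xᵏ-nonZero = m^n≢0 x k
    zᵏ-nonZero : NonZero (z ^ k)
    zᵏ-nonZero = m^n≢0 z k
    A-nonZero : NonZero A
    A-nonZero = m*n≢0 d₂ (x ^ k)
    B-nonZero : NonZero B
    B-nonZero = m*n≢0 d₁ (z ^ k)
    M-nonZero : NonZero M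
    M-nonZero = m*n≢0 (d₂ * x * (d₁ * z)) ((d₁ + d₂) * y)
                  {{m*n≢0 (d₂ * x) (d₁ * z) {{m*n≢0 d₂ x}} {{m*n≢0 d₁ z}}}} {{m*n≢0 (d₁ + d₂) y}}
    P-nonZero : NonZero P
    P-nonZero = m*n≢0 (d₂ * d₁) (d₁ + d₂) {{m*n≢0 d₂ d₁}}

  ABC≼M : A * B * C PrimeDivisorsDivide M
  ABC≼M = *-primeDivisorsDivide
            (*-primeDivisorsDivide (*^-primeDivisorsDivide d₂ x k) (*^-primeDivisorsDivide d₁ z k))
            (*^-primeDivisorsDivide (d₁ + d₂) y k)

  gcd₃∣P : gcd₃ A B C ∣ P
  gcd₃∣P = gcd₃[ux,vy,wz]∣uvw d₂ d₁ (d₁ + d₂) {x ^ k} {z ^ k} {y ^ k} (gcd₃-^ k coprime)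

abc-three-powers-bound : ∀ {K N k d₁ d₂ x y z} → ABC[ε=1] K → 6 ≤ k →
  .{{_ : NonZero d₁}} .{{_ : NonZero d₂}} .{{_ : NonZero x}} .{{_ : NonZero y}} .{{_ : NonZero z}} →
  gcd₃ x z y ≡ 1 → d₂ * x ^ k + d₁ * z ^ k ≡ (d₁ + d₂) * y ^ k →
  x ≤ z → y ≤ z → d₁ + d₂ ≤ N → z ^ (k ∸ 6) ≤ K * N ^ 9
abc-three-powers-bound {K} {N} {k} {d₁} {d₂} {x} {y} {z} abc 6≤k coprime identity x≤z y≤z d₁+d₂≤N =
  *-cancelʳ-≤ (z ^ (k ∸ 6)) (K * N ^ 9) (z ^ 6) {{m^n≢0 z 6}} (begin
    z ^ (k ∸ 6) * z ^ 6                                ≡⟨ ^-distribˡ-+-* z (k ∸ 6) 6 ⟨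
    z ^ (k ∸ 6 + 6)                                    ≡⟨ cong (z ^_) (m∸n+n≡m 6≤k) ⟩
    z ^ k                                              ≤⟨ m≤n*m (z ^ k) d₁ ⟩
    d₁ * z ^ k                                         ≤⟨ m≤n+m (d₁ * z ^ k) (d₂ * x ^ k) ⟩
    d₂ * x ^ k + d₁ * z ^ k                            ≡⟨ identity ⟩
    (d₁ + d₂) * y ^ k                                  ≤⟨ abc-three-powers {K} {k} abc coprime identity ⟩
    K * (d₂ * x * (d₁ * z) * ((d₁ + d₂) * y)) ^ 2 * (d₂ * d₁ * (d₁ + d₂))
                                                       ≤⟨ *-mono-≤ (*-monoʳ-≤ K (^-monoˡ-≤ 2 M≤[Nz]³)) P≤N³ ⟩
    K * (N * z * (N * z) * (N * z)) ^ 2 * (N * N * N)  ≡⟨ regroup K N z ⟩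
    K * N ^ 9 * z ^ 6                                  ∎)
  where
  open ≤-Reasoning
  open +-*-Solver
  regroup : ∀ K N z → K * (N * z * (N * z) * (N * z)) ^ 2 * (N * N * N) ≡ K * N ^ 9 * z ^ 6
  regroup = solve 3 (λ K N z → K :* (N :* z :* (N :* z) :* (N :* z)) :^ 2 :* (N :* N :* N)
                             := K :* N :^ 9 :* z :^ 6) refl

  d₁≤N : d₁ ≤ N
  d₁≤N = ≤-trans (m≤m+n d₁ d₂) d₁+d₂≤N

  d₂≤N : d₂ ≤ N
  d₂≤N = ≤-trans (m≤n+m d₂ d₁) d₁+d₂≤N

  P≤N³ : d₂ * d₁ * (d₁ + d₂) ≤ N * N * N
  P≤N³ = *-mono-≤ (*-mono-≤ d₂≤N d₁≤N) d₁+d₂≤N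

  M≤[Nz]³ : d₂ * x * (d₁ * z) * ((d₁ + d₂) * y) ≤ N * z * (N * z) * (N * z)
  M≤[Nz]³ = *-mono-≤ (*-mono-≤ (*-mono-≤ d₂≤N x≤z) (*-mono-≤ d₁≤N ≤-refl)) (*-mono-≤ d₁+d₂≤N y≤z)

abc-powers-in-AP : ∀ {K N k a q i j l t x y z} → ABC[ε=1] K → 6 ≤ k →
  .{{_ : NonZero t}} .{{_ : NonZero x}} →
  (x * t) ^ k ≡ a + i * q → (y * t) ^ k ≡ a + j * q → (z * t) ^ k ≡ a + l * q →
  i < j → j < l → l ≤ N → gcd₃ x z y ≡ 1 → z ^ (k ∸ 6) ≤ K * N ^ 9
abc-powers-in-AP {K} {N} {k} {a} {q} {i} {j} {l} {t} {x} {y} {z} abc 6≤k xₜ yₜ zₜ i<j j<l l≤N coprime =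
  abc-three-powers-bound {K} {N} {k} {d₁} {d₂} {x} {y} {z} abc 6≤k coprime identity x≤z y≤z d₁+d₂≤N
  where
  d₁ d₂ : ℕ
  d₁ = j ∸ i
  d₂ = l ∸ j
  instance
    k-nonZero : NonZero k
    k-nonZero = nonZero-≤ 6≤k
    d₁-nonZero : NonZero d₁
    d₁-nonZero = >-nonZero (m<n⇒0<n∸m i<j)
    d₂-nonZero : NonZero d₂
    d₂-nonZero = >-nonZero (m<n⇒0<n∸m j<l)

  i+d₁≡j : i + d₁ ≡ j
  i+d₁≡j = m+[n∸m]≡n (<⇒≤ i<j)

  i+d₁+d₂≡l : i + d₁ + d₂ ≡ l
  i+d₁+d₂≡l = trans (cong (_+ d₂) i+d₁≡j) (m+[n∸m]≡n (<⇒≤ j<l))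

  identity : d₂ * x ^ k + d₁ * z ^ k ≡ (d₁ + d₂) * y ^ k
  identity = powers-in-AP {a} {q} {i} {d₁} {d₂} {k} {t} {x} {y} {z} xₜ
    (trans yₜ (cong (λ n → a + n * q) (sym i+d₁≡j)))
    (trans zₜ (cong (λ n → a + n * q) (sym i+d₁+d₂≡l)))

  d₁+d₂≤N : d₁ + d₂ ≤ N
  d₁+d₂≤N = begin
    d₁ + d₂       ≤⟨ m≤n+m (d₁ + d₂) i ⟩
    i + (d₁ + d₂) ≡⟨ +-assoc i d₁ d₂ ⟨
    i + d₁ + d₂   ≡⟨ i+d₁+d₂≡l ⟩
    l             ≤⟨ l≤N ⟩
    N             ∎
    where open ≤-Reasoning

  x≤y : x ≤ y
  x≤y = *-cancelʳ-≤ x y t (AP-powers-mono k {x * t} {y * t} xₜ yₜ (<⇒≤ i<j))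

  x≤z : x ≤ z
  x≤z = *-cancelʳ-≤ x z t (AP-powers-mono k {x * t} {z * t} xₜ zₜ (<⇒≤ (<-trans i<j j<l)))

  y≤z : y ≤ z
  y≤z = *-cancelʳ-≤ y z t (AP-powers-mono k {y * t} {z * t} yₜ zₜ (<⇒≤ j<l))

  instance
    y-nonZero : NonZero y
    y-nonZero = nonZero-≤ x≤y
    z-nonZero : NonZero z
    z-nonZero = nonZero-≤ x≤z

length≤1+length-filter-< : ∀ {B ns} → Unique ns → All (_≤ B) ns → length ns ≤ suc (length (filter (_<? B) ns))
length≤1+length-filter-< [] [] = z≤n
length≤1+length-filter-< {B} {n ∷ ns} (n∉ns ∷ distinct) (n≤B ∷ ns≤B) with n <? B
... | yes n<B = ≤-trans (s≤s (length≤1+length-filter-< distinct ns≤B))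
                        (≤-reflexive (cong (suc ∘ length) (sym (filter-accept (_<? B) n<B))))
... | no n≮B  =
  s≤s (≤-reflexive (cong length (sym (trans (filter-reject (_<? B) n≮B) (filter-all (_<? B) ns<B)))))
  where
  ns<B : All (_< B) ns
  ns<B = All.zipWith (λ (n≢m , m≤B) → ≤∧≢⇒< m≤B (λ m≡B → n≢m (trans (≤-antisym n≤B (≮⇒≥ n≮B)) (sym m≡B))))
                     (n∉ns , ns≤B)

unique-bounded-length : ∀ {B ns} → Unique ns → All (_< B) ns → length ns ≤ B
unique-bounded-length {zero}  {[]}    _ []       = z≤n
unique-bounded-length {suc B} {ns} distinct ns<1+B = ≤-trans
  (length≤1+length-filter-< distinct (All.map s≤s⁻¹ ns<1+B))
  (s≤s (unique-bounded-length (Unique.filter⁺ (_<? B) distinct) (All.all-filter (_<? B) ns)))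

Unique-map⁺-on : ∀ {P : ℕ → Set} (f : ℕ → ℕ) {ns} → (∀ {m n} → P m → P n → f m ≡ f n → m ≡ n) →
                 All P ns → Unique ns → Unique (map f ns)
Unique-map⁺-on f injective [] [] = []
Unique-map⁺-on f injective (pn ∷ pns) (n∉ns ∷ distinct) =
  All.map⁺ (All.zipWith (λ (pm , n≢m) → n≢m ∘ injective pn pm) (pns , n∉ns))
  ∷ Unique-map⁺-on f injective pns distinct

+-*-injective : ∀ {n} u v u′ v′ .{{_ : NonZero n}} → v < n → v′ < n →
                v + u * n ≡ v′ + u′ * n → u ≡ u′ × v ≡ v′
+-*-injective {n} u v u′ v′ v<n v′<n eq =
  *-cancelʳ-≡ u u′ n (+-cancelˡ-≡ v _ _ (trans eq (cong (_+ u′ * n) (sym v≡v′)))) , v≡v′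
  where
  open ≡-Reasoning
  v≡v′ : v ≡ v′
  v≡v′ = begin
    v                   ≡⟨ m<n⇒m%n≡m v<n ⟨
    v % n               ≡⟨ [m+kn]%n≡m%n v u n ⟨
    (v + u * n) % n     ≡⟨ cong (_% n) eq ⟩
    (v′ + u′ * n) % n   ≡⟨ [m+kn]%n≡m%n v′ u′ n ⟩
    v′ % n              ≡⟨ m<n⇒m%n≡m v′<n ⟩
    v′                  ∎

2+[1+n]²≤6n² : ∀ n .{{_ : NonZero n}} → 2 + suc n * suc n ≤ 6 * (n * n)
2+[1+n]²≤6n² (suc m) = begin
  2 + suc (suc m) * suc (suc m)                          ≤⟨ m≤m+n _ (5 * (m * m) + 8 * m) ⟩
  2 + suc (suc m) * suc (suc m) + (5 * (m * m) + 8 * m)  ≡⟨ expand m ⟩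
  6 * (suc m * suc m)                                    ∎
  where
  open ≤-Reasoning
  expand : ∀ m → 2 + (2 + m) * (2 + m) + (5 * (m * m) + 8 * m) ≡ 6 * ((1 + m) * (1 + m))
  expand = solve-∀

[n*n]^k≤B³ : ∀ {n B} k .{{_ : NonZero n}} → 18 ≤ k → n ^ (k ∸ 6) ≤ B → (n * n) ^ k ≤ B * B * B
[n*n]^k≤B³ {n} {B} k 18≤k nᵏ⁻⁶≤B = begin
  (n * n) ^ k                        ≡⟨ ^-distribʳ-* n n k ⟩
  n ^ k * n ^ k                      ≡⟨ cong (λ e → e * e) nᵏ≡nᵏ⁻⁶*n⁶ ⟩
  E * n ^ 6 * (E * n ^ 6)            ≡⟨ interchange *-commutativeSemigroup E (n ^ 6) E (n ^ 6) ⟩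
  E * E * (n ^ 6 * n ^ 6)            ≡⟨ cong (E * E *_) (^-distribˡ-+-* n 6 6) ⟨
  E * E * n ^ 12                     ≤⟨ *-monoʳ-≤ (E * E) (^-monoʳ-≤ n (∸-monoˡ-≤ 6 18≤k)) ⟩
  E * E * E                          ≤⟨ *-mono-≤ (*-mono-≤ nᵏ⁻⁶≤B nᵏ⁻⁶≤B) nᵏ⁻⁶≤B ⟩
  B * B * B                          ∎
  where
  open ≤-Reasoning
  E : ℕ
  E = n ^ (k ∸ 6)
  nᵏ≡nᵏ⁻⁶*n⁶ : n ^ k ≡ E * n ^ 6
  nᵏ≡nᵏ⁻⁶*n⁶ = trans (cong (n ^_) (sym (m∸n+n≡m (≤-trans (m≤m+n 6 12) 18≤k)))) (^-distribˡ-+-* n (k ∸ 6) 6)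

kthRoot : ℕ → ℕ → ℕ
kthRoot k n with isKthPowerDec k n
... | yes n-power = proj₁ (Any.satisfied n-power)
... | no _        = 0

kthRoot-spec : ∀ k n → isKthPower? k n → kthRoot k n ^ k ≡ n
kthRoot-spec k n n-power with isKthPowerDec k n
... | yes n-power′ = proj₂ (Any.satisfied n-power′)
... | no ¬n-power  = contradiction n-power ¬n-power

small-bound : ∀ {K N k m} .{{_ : NonZero N}} → m ≤ 6 → m ^ k ≤ (6 * suc K) ^ k * N ^ 61
small-bound {K} {N} {k} m≤6 = ≤-trans (^-monoˡ-≤ k (≤-trans m≤6 (m≤m*n 6 (suc K))))
                                      (m≤m*n ((6 * suc K) ^ k) (N ^ 61) {{m^n≢0 N 61}})

large-bound : ∀ {K N k m n} .{{_ : NonZero N}} .{{_ : NonZero n}} → 62 ≤ k →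
              n ^ (k ∸ 6) ≤ K * N ^ 9 → m ≤ 6 * (n * n) → m ^ k ≤ (6 * suc K) ^ k * N ^ 61
large-bound {K} {N} {k} {m} {n} 62≤k nᵏ⁻⁶≤KN⁹ m≤6n² = begin
  m ^ k                                          ≤⟨ ^-monoˡ-≤ k m≤6n² ⟩
  (6 * (n * n)) ^ k                              ≡⟨ ^-distribʳ-* 6 (n * n) k ⟩
  6 ^ k * (n * n) ^ k                            ≤⟨ *-monoʳ-≤ (6 ^ k) ([n*n]^k≤B³ k 18≤k nᵏ⁻⁶≤KN⁹) ⟩
  6 ^ k * (K * N ^ 9 * (K * N ^ 9) * (K * N ^ 9)) ≡⟨ cong (6 ^ k *_) (regroup K N) ⟩
  6 ^ k * (K * K * K * N ^ 27)                   ≤⟨ *-monoʳ-≤ (6 ^ k) (*-mono-≤ K³≤[1+K]ᵏ (^-monoʳ-≤ N 27≤61)) ⟩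
  6 ^ k * (suc K ^ k * N ^ 61)                   ≡⟨ *-assoc (6 ^ k) (suc K ^ k) (N ^ 61) ⟨
  6 ^ k * suc K ^ k * N ^ 61                     ≡⟨ cong (_* N ^ 61) (^-distribʳ-* 6 (suc K) k) ⟨
  (6 * suc K) ^ k * N ^ 61                       ∎
  where
  open ≤-Reasoning
  open +-*-Solver
  18≤k : 18 ≤ k
  18≤k = ≤-trans (m≤m+n 18 44) 62≤k
  27≤61 : 27 ≤ 61
  27≤61 = m≤m+n 27 34
  regroup : ∀ K N → K * N ^ 9 * (K * N ^ 9) * (K * N ^ 9) ≡ K * K * K * N ^ 27
  regroup = solve 2 (λ K N → K :* N :^ 9 :* (K :* N :^ 9) :* (K :* N :^ 9) := K :* K :* K :* N :^ 27) refl
  K³≤[1+K]ᵏ : K * K * K ≤ suc K ^ k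
  K³≤[1+K]ᵏ = begin
    K * K * K                  ≤⟨ *-mono-≤ (*-mono-≤ (n≤1+n K) (n≤1+n K)) (n≤1+n K) ⟩
    suc K * suc K * suc K      ≡⟨ solve 1 (λ L → L :* L :* L := L :^ 3) refl (suc K) ⟩
    suc K ^ 3                  ≤⟨ ^-monoʳ-≤ (suc K) (≤-trans (m≤m+n 3 59) 62≤k) ⟩
    suc K ^ k                  ∎

Q≤N : ∀ k N q a → Q k N q a ≤ N
Q≤N k N q a = begin
  Q k N q a                  ≤⟨ length-filter (λ i → isKthPowerDec k (a + i * q)) (map suc (upTo N)) ⟩
  length (map suc (upTo N))  ≡⟨ trans (length-map suc (upTo N)) (length-upTo N) ⟩
  N                          ∎
  where open ≤-Reasoning

module KthPowersInAP {K} (abc : ABC[ε=1] K) (k N q a : ℕ) (62≤k : 62 ≤ k)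
                     .{{_ : NonZero N}} .{{_ : NonZero q}} where

  instance
    k-nonZero : NonZero k
    k-nonZero = nonZero-≤ 62≤k

  Good : ℕ → Set
  Good i = isKthPower? k (a + i * q) × 1 ≤ i × i ≤ N

  goodIndices : List ℕ
  goodIndices = filter (λ i → isKthPowerDec k (a + i * q)) (map suc (upTo N))

  goodIndices-sorted : AllPairs _<_ goodIndices
  goodIndices-sorted = AllPairs.filter⁺ _ (AllPairs.map⁺ (AllPairs.applyUpTo⁺₁ id N (λ i<j _ → s<s i<j)))

  goodIndices-good : All Good goodIndices
  goodIndices-good = All.zip
    ( All.all-filter _ (map suc (upTo N))
    , All.filter⁺ _ (All.map⁺ (All.applyUpTo⁺₁ id N (λ i<N → s≤s z≤n , i<N))))

  root : ℕ → ℕ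
  root i = kthRoot k (a + i * q)

  root-spec : ∀ {i} → Good i → root i ^ k ≡ a + i * q
  root-spec {i} (i-power , _) = kthRoot-spec k (a + i * q) i-power

  root-nonZero : ∀ {i} → Good i → NonZero (root i)
  root-nonZero {i} good@(_ , 1≤i , _) = m^n≢0⇒m≢0 (root i) k
    where
    instance
      i-nonZero : NonZero i
      i-nonZero = >-nonZero 1≤i
      rootᵏ-nonZero : NonZero (root i ^ k)
      rootᵏ-nonZero = subst NonZero (sym (root-spec good)) (nonZero-≤ (m≤n+m (i * q) a) {{m*n≢0 i q}})

  root-injective : ∀ {i j} → Good i → Good j → root i ≡ root j → i ≡ j
  root-injective {i} {j} good-i good-j root-i≡root-j = *-cancelʳ-≡ i j q (+-cancelˡ-≡ a _ _ (begin
    a + i * q   ≡⟨ root-spec good-i ⟨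
    root i ^ k  ≡⟨ cong (_^ k) root-i≡root-j ⟩
    root j ^ k  ≡⟨ root-spec good-j ⟩
    a + j * q   ∎))
    where open ≡-Reasoning

  root-mono : ∀ {i j} → Good i → Good j → i ≤ j → root i ≤ root j
  root-mono good-i good-j = AP-powers-mono k (root-spec good-i) (root-spec good-j)

  module AfterPair {i₁ i₂} (good₁ : Good i₁) (good₂ : Good i₂) (i₁<i₂ : i₁ < i₂) where

    Later : ℕ → Set
    Later r = Good r × i₂ < r

    instance
      root₁-nonZero : NonZero (root i₁)
      root₁-nonZero = root-nonZero good₁

    reduced : ∀ r → ScaledPrimitive (root i₁) (root r) (root i₂)
    reduced r = scaledPrimitive (root i₁) (root r) (root i₂)

    den num : ℕ → ℕ
    den r = ScaledPrimitive.a′ (reduced r)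
    num r = ScaledPrimitive.b′ (reduced r)

    den-nonZero : ∀ r → NonZero (den r)
    den-nonZero r = nonZero-factorˡ {d = scale} a≡a′*scale
      where open ScaledPrimitive (reduced r)

    root-ratio : ∀ r → root r * den r ≡ num r * root i₁
    root-ratio r = begin
      root r * den r           ≡⟨ cong (_* den r) b≡b′*scale ⟩
      num r * scale * den r    ≡⟨ *-assoc (num r) scale (den r) ⟩
      num r * (scale * den r)  ≡⟨ cong (num r *_) (*-comm scale (den r)) ⟩
      num r * (den r * scale)  ≡⟨ cong (num r *_) a≡a′*scale ⟨
      num r * root i₁          ∎
      where
      open ≡-Reasoning
      open ScaledPrimitive (reduced r)

    den≤num : ∀ {r} → Later r → den r ≤ num r
    den≤num {r} (good-r , i₂<r) = *-cancelʳ-≤ (den r) (num r) scale {{nonZero-factorʳ {m = den r} a≡a′*scale}}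
      (subst₂ _≤_ a≡a′*scale b≡b′*scale (root-mono good₁ good-r (<⇒≤ (<-trans i₁<i₂ i₂<r))))
      where open ScaledPrimitive (reduced r)

    num-bound : ∀ {r} → Later r → num r ^ (k ∸ 6) ≤ K * N ^ 9
    num-bound {r} (good-r@(_ , _ , r≤N) , i₂<r) =
      abc-powers-in-AP {K} {N} {k} {a} {q} {i₁} {i₂} {r} {scale} {den r} {c′} {num r}
        abc (≤-trans (m≤m+n 6 56) 62≤k) {{nonZero-factorʳ {m = den r} a≡a′*scale}} {{den-nonZero r}}
        (trans (cong (_^ k) (sym a≡a′*scale)) (root-spec good₁))
        (trans (cong (_^ k) (sym c≡c′*scale)) (root-spec good₂))
        (trans (cong (_^ k) (sym b≡b′*scale)) (root-spec good-r))
        i₁<i₂ i₂<r r≤N coprime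
      where open ScaledPrimitive (reduced r)

    length-later≤ : ∀ {D rs} → Unique rs → All Later rs → All (λ r → num r ≤ D) rs → length rs ≤ suc D * suc D
    length-later≤ {D} {rs} distinct later num≤D = begin
      length rs                 ≡⟨ length-map code rs ⟨
      length (map code rs)      ≤⟨ unique-bounded-length (Unique-map⁺-on code code-injective bounded distinct)
                                                         (All.map⁺ (All.map code< bounded)) ⟩
      suc D * suc D             ∎
      where
      open ≤-Reasoning
      code : ℕ → ℕ
      code r = den r + num r * suc D

      bounded : All (λ r → Later r × num r ≤ D) rs
      bounded = All.zip (later , num≤D)

      den<1+D : ∀ {r} → Later r × num r ≤ D → den r < suc D
      den<1+D (later-r , num-r≤D) = s≤s (≤-trans (den≤num later-r) num-r≤D)

      code< : ∀ {r} → Later r × num r ≤ D → code r < suc D * suc D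
      code< r-bounded@(_ , num-r≤D) = s≤s (+-mono-≤ (s≤s⁻¹ (den<1+D r-bounded)) (*-monoˡ-≤ (suc D) num-r≤D))

      code-injective : ∀ {r s} → Later r × num r ≤ D → Later s × num s ≤ D → code r ≡ code s → r ≡ s
      code-injective {r} {s} r-bounded@((good-r , _) , _) s-bounded@((good-s , _) , _) code-r≡code-s
        with num-r≡num-s , den-r≡den-s ← +-*-injective (num r) (den r) (num s) (den s)
                                            (den<1+D r-bounded) (den<1+D s-bounded) code-r≡code-s
        = root-injective good-r good-s (*-cancelʳ-≡ (root r) (root s) (den r) {{den-nonZero r}} (begin-equality
          root r * den r   ≡⟨ root-ratio r ⟩
          num r * root i₁  ≡⟨ cong (_* root i₁) num-r≡num-s ⟩
          num s * root i₁  ≡⟨ root-ratio s ⟨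
          root s * den s   ≡⟨ cong (root s *_) den-r≡den-s ⟨
          root s * den r   ∎))

    later-count : ∀ r rs → Unique (r ∷ rs) → All Later (r ∷ rs) →
                  ∃ λ D → NonZero D × D ^ (k ∸ 6) ≤ K * N ^ 9 × length (r ∷ rs) ≤ suc D * suc D
    later-count r rs distinct later@(later-r ∷ later-rs) =
      num r* , nonZero-≤ (den≤num later-r*) {{den-nonZero r*}} , num-bound later-r*
             , length-later≤ distinct later (f[⊥]≤f[argmax] {f = num} r rs ∷ f[xs]≤f[argmax] {f = num} r rs)
      where
      r* : ℕ
      r* = argmax num r rs
      later-r* : Later r*
      later-r* = argmax-all num later-r later-rs

  length-bound : ∀ {is} → AllPairs _<_ is → All Good is →
                 length is ≤ 6 ⊎ ∃ λ D → NonZero D × D ^ (k ∸ 6) ≤ K * N ^ 9 × length is ≤ 6 * (D * D)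
  length-bound {[]}              _ _ = inj₁ z≤n
  length-bound {_ ∷ []}          _ _ = inj₁ (s≤s z≤n)
  length-bound {_ ∷ _ ∷ []}      _ _ = inj₁ (s≤s (s≤s z≤n))
  length-bound {i₁ ∷ i₂ ∷ r ∷ rs} ((i₁<i₂ ∷ _) ∷ i₂<later ∷ sorted) (good₁ ∷ good₂ ∷ goods)
    with D , D-nonZero , D-bound , length≤ ← AfterPair.later-count good₁ good₂ i₁<i₂ r rs
           (AllPairs.map <⇒≢ sorted) (All.zip (goods , i₂<later))
    = inj₂ (D , D-nonZero , D-bound , ≤-trans (s≤s (s≤s length≤)) (2+[1+n]²≤6n² D {{D-nonZero}}))

  Qᵏ-bound : Q k N q a ^ k ≤ (6 * suc K) ^ k * N ^ 61
  Qᵏ-bound with length-bound goodIndices-sorted goodIndices-good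
  ... | inj₁ Q≤6 = small-bound {K} {N} {k} Q≤6
  ... | inj₂ (D , D-nonZero , D-bound , Q≤6D²) = large-bound {K} {N} {k} 62≤k D-bound Q≤6D²
    where
    instance
      D-instance : NonZero D
      D-instance = D-nonZero

Q-bound : ∀ {K} → ABC[ε=1] K → ∀ k N q a .{{_ : NonZero N}} .{{_ : NonZero q}} →
          Q k N q a ^ k ≤ (6 * suc K) ^ k * N ^ 61
Q-bound {K} abc k N q a with k ≤? 61
... | yes k≤61 = begin
  Q k N q a ^ k             ≤⟨ ^-monoˡ-≤ k (Q≤N k N q a) ⟩
  N ^ k                     ≤⟨ ^-monoʳ-≤ N k≤61 ⟩
  N ^ 61                    ≤⟨ m≤n*m (N ^ 61) ((6 * suc K) ^ k) {{m^n≢0 (6 * suc K) k}} ⟩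
  (6 * suc K) ^ k * N ^ 61  ∎
  where open ≤-Reasoning
... | no k≰61 = KthPowersInAP.Qᵏ-bound abc k N q a (≰⇒> k≰61)

proposition6p8 : ABC →
    ∃ λ (C : ℕ) → (k N : ℕ) → 2 ≤ k → 1 ≤ N →
      (q a : ℕ) → 1 ≤ q →
        Q k N q a ^ k ≤ C ^ k * N ^ 61
-- The bound holds for every k.
proposition6p8 abc with K , abc-K ← ABC⇒ABC[ε=1] abc =
  6 * suc K , λ k N _ 1≤N q a 1≤q → Q-bound abc-K k N q a {{>-nonZero 1≤N}} {{>-nonZero 1≤q}}
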